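{- Let $q$ be a prime power and $\alpha$ a primitive element of $\mathbb{F}_{q^5}$ (identified with $\mathbb{F}_q^5$). Then the $3$-dimensional subspaces $\langle\alpha^0,\alpha^1,\alpha^2\rangle$ and $\langle\alpha^0,\alpha^1,\alpha^3\rangle$ lie in different equivalence classes of $E_3$.
   Context: $\langle v_1,\ldots,v_m\rangle$ denotes the $\mathbb{F}_q$-linear span. For a subspace $X$ and nonzero $\beta\in\mathbb{F}_{q^5}$, $\beta X=\{\beta x:x\in X\}$. $E_3$ is the equivalence relation on $3$-dimensional subspaces of $\mathbb{F}_q^5$ given by $(X,Y)\in E_3$ iff $Y=\alpha^jX$ for some integer $j$. -}

module Defs where

open import Level using (Level; _⊔_)
open import Data.Nat using (ℕ; zero; suc) renaming (_^_ to _^ℕ_)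
open import Data.Nat.Primality using (Prime)
open import Data.Integer using (ℤ; +_; -[1+_])
open import Data.Fin using (Fin)
open import Data.Product using (Σ; ∃; _×_; _,_)
open import Relation.Nullary using (¬_)
open import Relation.Binary.PropositionalEquality using (_≡_)
import Relation.Binary.PropositionalEquality as ≡
open import Function.Bundles using (Inverse; _⇔_)
open import Algebra.Bundles using (CommutativeRing)

IsPrimePower : ℕ → Set
IsPrimePower q = Σ ℕ λ p → Σ ℕ λ k → Prime p × q ≡ p ^ℕ suc k

module _ {c ℓ : Level} (K : CommutativeRing c ℓ) where
  open CommutativeRing K

  record IsField : Set (c ⊔ ℓ) where
    field
      _⁻¹      : Carrier → Carrier
      1≉0      : ¬ (1# ≈ 0#)
      inverseʳ : ∀ x → ¬ (x ≈ 0#) → (x * (x ⁻¹)) ≈ 1#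

  HasCard : ℕ → Set (c ⊔ ℓ)
  HasCard n = Inverse setoid (≡.setoid (Fin n))

  pow : Carrier → ℕ → Carrier
  pow x zero    = 1#
  pow x (suc n) = x * pow x n

  record IsFiniteField (q : ℕ) : Set (c ⊔ ℓ) where
    field
      isField : IsField
      card    : HasCard (q ^ℕ 5)
    open IsField isField public

  module _ {q : ℕ} (FF : IsFiniteField q) where
    open IsFiniteField FF

    zpow : Carrier → ℤ → Carrier
    zpow x (+ n)     = pow x n
    zpow x -[1+ n ]  = pow (x ⁻¹) (suc n)

    IsPrimitive : Carrier → Set (c ⊔ ℓ)
    IsPrimitive α = ¬ (α ≈ 0#) × (∀ x → ¬ (x ≈ 0#) → ∃ λ n → pow α n ≈ x)

    -- the subfield F_q of K = F_{q^5}: the fixed points of x ↦ x^q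
    InFq : Carrier → Set ℓ
    InFq a = pow a q ≈ a

    Subset : Set (Level.suc (c ⊔ ℓ))
    Subset = Carrier → Set (c ⊔ ℓ)

    span3 : Carrier → Carrier → Carrier → Subset
    span3 v₁ v₂ v₃ x = Σ Carrier λ a → Σ Carrier λ b → Σ Carrier λ d →
      InFq a × InFq b × InFq d × (x ≈ ((a * v₁) + (b * v₂)) + (d * v₃))

    scale : Carrier → Subset → Subset
    scale β X y = Σ Carrier λ x → X x × (y ≈ β * x)

    SameSet : Subset → Subset → Set (c ⊔ ℓ)
    SameSet X Y = ∀ x → X x ⇔ Y x

    E₃ : Carrier → Subset → Subset → Set (c ⊔ ℓ)
    E₃ α X Y = Σ ℤ λ j → SameSet Y (scale (zpow α j) X)

-- If ⟨1, α, α³⟩ = β⟨1, α, α²⟩ then β and βα both lie in ⟨1, α, α³⟩; comparing coordinates of α · β and βα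
-- with respect to 1, α, …, α⁴ forces β ∈ F_q, and then α³ ∈ β⟨1, α, α²⟩ = ⟨1, α, α²⟩, which is absurd.
-- Coordinates are unique because 1, α, …, α⁴ are F_q-linearly independent: |K| = q⁵ makes the characteristic
-- p, so x ↦ x^q is additive and fixes F_q; a relation P(α) = 0 of degree < 5 therefore also holds at the
-- conjugates α^(q^i), i < 5, which are distinct as α has order q⁵ − 1, so P = 0.

module Submission where

open import Defs
open import Level using (_⊔_)
open import Data.Nat as ℕ using (ℕ; zero; suc; _<_; _≤_; _∸_; _!; z≤n; s≤s)
import Data.Nat.Properties as ℕₚ
open import Data.Nat.Divisibility using (_∣_; divides; ∣⇒≤; ∣1⇒≡1; m∣m*n)
open import Data.Nat.DivMod using (_%_; _/_; m/n*n≡m; m≡m%n+[m/n]*n; m%n<n)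
open import Data.Nat.Combinatorics using (_C_; nCn≡1; nCk≡n!/k![n-k]!; k![n∸k]!∣n!)
open import Data.Nat.Primality using (Prime; euclidsLemma; ¬prime[0]; ¬prime[1]; prime⇒nonTrivial)
open import Data.Fin as Fin using (Fin; toℕ)
import Data.Fin.Properties as Finₚ
open import Data.Fin.Permutation using (Permutation; permutation)
open import Data.Vec using (Vec; []; _∷_; head; zipWith)
open import Data.Vec.Relation.Unary.All using (All; []; _∷_)
open import Data.Vec.Relation.Binary.Pointwise.Inductive using (Pointwise; []; _∷_)
open import Data.Product using (Σ; ∃; _,_; proj₁; proj₂)
open import Data.Sum using (inj₁; inj₂)
open import Function using (_∘_; case_of_)
open import Function.Bundles using (Inverse; Injection; Equivalence)
open import Function.Properties.Inverse using (Inverse⇒Injection)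
open import Function.Definitions using (Injective)
open import Relation.Nullary using (¬_; yes; no; contradiction)
open import Relation.Nullary.Decidable using (map′)
open import Relation.Binary.Definitions using (Decidable; tri<; tri≈; tri>)
open import Relation.Binary.PropositionalEquality as ≡ using (_≡_)
open import Algebra.Bundles using (CommutativeRing)

prime∤! : ∀ {p} → Prime p → ∀ m → m < p → ¬ p ∣ m !
prime∤! pp zero    _   p∣1  = ¬prime[1] (≡.subst Prime (∣1⇒≡1 p∣1) pp)
prime∤! pp (suc m) m<p p∣m! with euclidsLemma (suc m) (m !) pp p∣m!
... | inj₁ p∣1+m = ℕₚ.<⇒≱ m<p (∣⇒≤ p∣1+m)
... | inj₂ p∣m!′ = prime∤! pp m (ℕₚ.<-trans (ℕₚ.n<1+n m) m<p) p∣m!′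

-- p divides p! = (p C k) · k! · (p ∸ k)! but neither factorial on the right.
prime∣binomial : ∀ {p k} → Prime p → 0 < k → k < p → p ∣ p C k
prime∣binomial {p@(suc p-1)} {k} pp 0<k k<p
  with euclidsLemma (p C k) (k ! ℕ.* (p ∸ k) !) pp p∣pCk*denominator
  where
  k≤p = ℕₚ.<⇒≤ k<p
  instance _ = k ℕₚ.!* (p ∸ k) !≢0
  p∣pCk*denominator : p ∣ (p C k) ℕ.* (k ! ℕ.* (p ∸ k) !)
  p∣pCk*denominator = ≡.subst (p ∣_)
    (≡.sym (≡.trans (≡.cong (ℕ._* (k ! ℕ.* (p ∸ k) !)) (nCk≡n!/k![n-k]! k≤p)) (m/n*n≡m (k![n∸k]!∣n! k≤p))))
    (m∣m*n (p-1 !))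
... | inj₁ p∣pCk = p∣pCk
... | inj₂ p∣denominator with euclidsLemma (k !) ((p ∸ k) !) pp p∣denominator
...   | inj₁ p∣k! = contradiction p∣k! (prime∤! pp k k<p)
...   | inj₂ p∣[p∸k]! = contradiction p∣[p∸k]! (prime∤! pp (p ∸ k) (ℕₚ.∸-monoʳ-< 0<k (ℕₚ.<⇒≤ k<p)))

module RingProperties {c ℓ} (R : CommutativeRing c ℓ) where
  open CommutativeRing R
  open import Relation.Binary.Reasoning.Setoid setoid
  open import Algebra.Properties.Semiring.Exp semiring using (_^_; ^-congˡ; ^-congʳ; ^-assocʳ)
  open import Algebra.Properties.Semiring.Mult semiring using (_×_; ×-cong; ×-congʳ; ×-congˡ; ×-assocˡ; ×-assoc-*)
  open import Algebra.Properties.Semiring.Sum semiring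
    using (sum; sum-cong-≋; sum-replicate; sum-replicate-zero; sum-init-last; ∑-distrib-+; sum-permute)
  open import Algebra.Properties.CommutativeSemiring.Binomial commutativeSemiring
    using (theorem; binomialTerm)
  open import Algebra.Properties.Group +-group
    using (\\-leftDividesˡ; \\-leftDividesʳ; identityˡ-unique; identityʳ-unique; inverseʳ-unique)
  open import Algebra.Properties.AbelianGroup +-abelianGroup using (⁻¹-∙-comm)
  open import Algebra.Properties.CommutativeSemigroup +-commutativeSemigroup using (interchange)
  open import Algebra.Properties.Ring ring using (-‿distribˡ-*)
  open import Algebra.Properties.CommutativeSemiring.Exp commutativeSemiring using (^-distrib-*)
  open import Algebra.Solver.Ring.NaturalCoefficients.Default commutativeSemiring

  pow≈^ : ∀ x n → pow R x n ≈ x ^ n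
  pow≈^ x zero    = refl
  pow≈^ x (suc n) = *-congˡ (pow≈^ x n)

  1#^≈1# : ∀ n → 1# ^ n ≈ 1#
  1#^≈1# zero    = refl
  1#^≈1# (suc n) = trans (*-identityˡ _) (1#^≈1# n)

  ^-swap : ∀ x m n → (x ^ m) ^ n ≈ (x ^ n) ^ m
  ^-swap x m n = trans (^-assocʳ x m n) (trans (^-congʳ x (ℕₚ.*-comm m n)) (sym (^-assocʳ x n m)))

  module _ {n} (card : HasCard R n) where
    private module C = Inverse card

    translation : Carrier → Permutation n n
    translation a = permutation (λ i → C.to (a + C.from i)) (λ i → C.to (- a + C.from i))
      (λ i → ≡.trans (C.to-cong (+-congˡ (C.strictlyInverseʳ _))) (≡.trans (C.to-cong (\\-leftDividesˡ a _)) (C.strictlyInverseˡ i)))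
      (λ i → ≡.trans (C.to-cong (+-congˡ (C.strictlyInverseʳ _))) (≡.trans (C.to-cong (\\-leftDividesʳ a _)) (C.strictlyInverseˡ i)))

    -- Summing all elements of R, before and after translating them by a.
    card×≈0 : ∀ a → n × a ≈ 0#
    card×≈0 a = identityˡ-unique (n × a) (sum C.from) (begin
      n × a + sum C.from                    ≈⟨ +-congʳ (sum-replicate n) ⟨
      sum {n} (λ _ → a) + sum C.from        ≈⟨ ∑-distrib-+ (λ _ → a) C.from ⟨
      sum (λ i → a + C.from i)              ≈⟨ sum-cong-≋ (λ i → C.strictlyInverseʳ (a + C.from i)) ⟨
      sum (λ i → C.from (C.to (a + C.from i))) ≈⟨ sum-permute C.from (translation a) ⟨
      sum C.from                            ∎)

  Additive : ℕ → Set (c ⊔ ℓ)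
  Additive e = ∀ x y → (x + y) ^ e ≈ x ^ e + y ^ e

  additive-* : ∀ {m n} → Additive m → Additive n → Additive (m ℕ.* n)
  additive-* {m} {n} add-m add-n x y = begin
    (x + y) ^ (m ℕ.* n)           ≈⟨ ^-assocʳ (x + y) m n ⟨
    ((x + y) ^ m) ^ n             ≈⟨ ^-congˡ n (add-m x y) ⟩
    (x ^ m + y ^ m) ^ n           ≈⟨ add-n (x ^ m) (y ^ m) ⟩
    (x ^ m) ^ n + (y ^ m) ^ n     ≈⟨ +-cong (^-assocʳ x m n) (^-assocʳ y m n) ⟩
    x ^ (m ℕ.* n) + y ^ (m ℕ.* n) ∎

  additive-^ : ∀ {m} → Additive m → ∀ j → Additive (m ℕ.^ j)
  additive-^ add-m zero    x y = trans (*-identityʳ _) (sym (+-cong (*-identityʳ x) (*-identityʳ y)))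
  additive-^ {m} add-m (suc j) = additive-* {m} {m ℕ.^ j} add-m (additive-^ add-m j)

  module _ {e} (add-e : Additive e) where
    additive⇒0#^≈0# : 0# ^ e ≈ 0#
    additive⇒0#^≈0# = identityʳ-unique (0# ^ e) (0# ^ e)
      (trans (sym (add-e 0# 0#)) (^-congˡ e (+-identityʳ 0#)))

    additive⇒^-‿distrib : ∀ x → (- x) ^ e ≈ - (x ^ e)
    additive⇒^-‿distrib x = inverseʳ-unique (x ^ e) ((- x) ^ e) (begin
      x ^ e + (- x) ^ e ≈⟨ add-e x (- x) ⟨
      (x - x) ^ e       ≈⟨ ^-congˡ e (-‿inverseʳ x) ⟩
      0# ^ e            ≈⟨ additive⇒0#^≈0# ⟩
      0#                ∎)

    additive⇒^-distrib-− : ∀ x y → (x - y) ^ e ≈ x ^ e - y ^ e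
    additive⇒^-distrib-− x y = trans (add-e x (- y)) (+-congˡ (additive⇒^-‿distrib y))

  module _ {p} (pp : Prime p) (char-p : p × 1# ≈ 0#) where
    private
      p×≈0# : ∀ w → p × w ≈ 0#
      p×≈0# w = begin
        p × w        ≈⟨ ×-congʳ p (*-identityˡ w) ⟨
        p × (1# * w) ≈⟨ ×-assoc-* p 1# w ⟨
        (p × 1#) * w ≈⟨ *-congʳ char-p ⟩
        0# * w       ≈⟨ zeroˡ w ⟩
        0#           ∎

    binomial×≈0# : ∀ {j} → 0 < j → j < p → ∀ w → (p C j) × w ≈ 0#
    binomial×≈0# {j} 0<j j<p w with divides m pCj≡m*p ← prime∣binomial pp 0<j j<p = begin
      (p C j) × w     ≈⟨ ×-congˡ (≡.trans pCj≡m*p (ℕₚ.*-comm m p)) ⟩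
      (p ℕ.* m) × w   ≈⟨ ×-assocˡ w p m ⟨
      p × (m × w)     ≈⟨ p×≈0# (m × w) ⟩
      0#              ∎

  -- In characteristic p the inner terms of the binomial expansion of (x + y) ^ p vanish.
  frobenius : ∀ {p} → Prime p → p × 1# ≈ 0# → Additive p
  frobenius {zero}      pp = contradiction pp ¬prime[0]
  frobenius {p@(suc n)} pp char-p x y = begin
    (x + y) ^ p                                                  ≈⟨ theorem p x y ⟩
    term Fin.zero + sum (λ i → term (Fin.suc i))                 ≈⟨ +-congˡ (sum-init-last (term ∘ Fin.suc)) ⟩
    term Fin.zero + (sum (λ i → term (Fin.suc (Fin.inject₁ i))) + term (Fin.fromℕ p))
      ≈⟨ +-congˡ (+-congʳ (trans (sum-cong-≋ inner≈0#) (sum-replicate-zero n))) ⟩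
    term Fin.zero + (0# + term (Fin.fromℕ p))                   ≈⟨ +-cong first≈ (trans (+-identityˡ _) last≈) ⟩
    y ^ p + x ^ p                                                ≈⟨ +-comm _ _ ⟩
    x ^ p + y ^ p                                                ∎
    where
    term = binomialTerm x y p
    first≈ : term Fin.zero ≈ y ^ p
    first≈ = trans (+-identityʳ _) (*-identityˡ _)
    last≈ : term (Fin.fromℕ p) ≈ x ^ p
    last≈ = top (toℕ (Fin.fromℕ p)) (Finₚ.toℕ-fromℕ p)
      where
      top : ∀ j → j ≡ p → (p C j) × (x ^ j * y ^ (p ∸ j)) ≈ x ^ p
      top j ≡.refl = trans (×-cong (nCn≡1 p) (*-congˡ (^-congʳ y (ℕₚ.n∸n≡0 p))))
                           (trans (+-identityʳ _) (*-identityʳ _))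
    inner≈0# : ∀ i → term (Fin.suc (Fin.inject₁ i)) ≈ 0#
    inner≈0# i = binomial×≈0# pp char-p (s≤s z≤n) (s≤s (Finₚ.inject₁ℕ< i)) _

  -- Polynomials are coefficient vectors, leading coefficient first.
  eval : ∀ {n} → Vec Carrier n → Carrier → Carrier
  eval []               x = 0#
  eval {suc n} (a ∷ as) x = a * x ^ n + eval as x

  eval-≈0#∷ : ∀ {n a} (as : Vec Carrier n) x → a ≈ 0# → eval (a ∷ as) x ≈ eval as x
  eval-≈0#∷ as x a≈0 = trans (+-congʳ (trans (*-congʳ a≈0) (zeroˡ _))) (+-identityˡ _)

  eval-zipWith-− : ∀ {n} (P Q : Vec Carrier n) x → eval (zipWith _-_ P Q) x ≈ eval P x - eval Q x
  eval-zipWith-− []       []       x = sym (-‿inverseʳ 0#)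
  eval-zipWith-− {suc n} (a ∷ P) (b ∷ Q) x = begin
    (a - b) * x ^ n + eval (zipWith _-_ P Q) x
      ≈⟨ +-cong (trans (distribʳ (x ^ n) a (- b)) (+-congˡ (sym (-‿distribˡ-* b (x ^ n))))) (eval-zipWith-− P Q x) ⟩
    (a * x ^ n - b * x ^ n) + (eval P x - eval Q x)
      ≈⟨ interchange _ _ _ _ ⟩
    (a * x ^ n + eval P x) + (- (b * x ^ n) - eval Q x)
      ≈⟨ +-congˡ (⁻¹-∙-comm _ _) ⟩
    (a * x ^ n + eval P x) - (b * x ^ n + eval Q x) ∎

  eval-^ : ∀ {e n} → Additive e → (P : Vec Carrier n) → All (λ a → a ^ e ≈ a) P →
           ∀ x → eval P (x ^ e) ≈ eval P x ^ e
  eval-^ {e} add-e []       []          x = sym (additive⇒0#^≈0# {e} add-e)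
  eval-^ {e} {suc n} add-e (a ∷ as) (a^e≈a ∷ fixed) x = begin
    a * (x ^ e) ^ n + eval as (x ^ e)   ≈⟨ +-cong (*-cong (sym a^e≈a) (^-swap x e n)) (eval-^ {e} add-e as fixed x) ⟩
    a ^ e * (x ^ n) ^ e + eval as x ^ e ≈⟨ +-congʳ (^-distrib-* a (x ^ n) e) ⟨
    (a * x ^ n) ^ e + eval as x ^ e     ≈⟨ add-e (a * x ^ n) (eval as x) ⟨
    (a * x ^ n + eval as x) ^ e         ∎

  -- Synthetic division by (X - r).
  divide : ∀ {n} → Carrier → Vec Carrier (suc n) → Vec Carrier n
  divide r (a ∷ [])     = []
  divide r (a ∷ b ∷ as) = a ∷ divide r (b + r * a ∷ as)

  -- P(x) = (x - r) Q(x) + P(r), with the terms moved so that no subtraction occurs.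
  eval-divide : ∀ {n} r x (P : Vec Carrier (suc n)) →
                eval P x + r * eval (divide r P) x ≈ x * eval (divide r P) x + eval P r
  eval-divide r x (a ∷ []) = begin
    (a * 1# + 0#) + r * 0# ≈⟨ +-congˡ (zeroʳ r) ⟩
    (a * 1# + 0#) + 0#     ≈⟨ +-identityʳ _ ⟩
    a * 1# + 0#            ≈⟨ +-identityˡ _ ⟨
    0# + (a * 1# + 0#)     ≈⟨ +-congʳ (zeroʳ x) ⟨
    x * 0# + (a * 1# + 0#) ∎
  eval-divide {suc n} r x (a ∷ b ∷ as) = begin
    (a * (x * X) + (b * X + E)) + r * (a * X + V)
      ≈⟨ solve 7 (λ a b r x X E V → (a :* (x :* X) :+ (b :* X :+ E)) :+ r :* (a :* X :+ V)
                                  := a :* x :* X :+ (((b :+ r :* a) :* X :+ E) :+ r :* V)) refl a b r x X E V ⟩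
    a * x * X + (((b + r * a) * X + E) + r * V)
      ≈⟨ +-congˡ (eval-divide r x (b + r * a ∷ as)) ⟩
    a * x * X + (x * V + ((b + r * a) * Rn + F))
      ≈⟨ solve 8 (λ a b r x X V Rn F → a :* x :* X :+ (x :* V :+ ((b :+ r :* a) :* Rn :+ F))
                                     := x :* (a :* X :+ V) :+ (a :* (r :* Rn) :+ (b :* Rn :+ F))) refl a b r x X V Rn F ⟩
    x * (a * X + V) + (a * (r * Rn) + (b * Rn + F)) ∎
    where
    X  = x ^ n
    Rn = r ^ n
    E  = eval as x
    F  = eval as r
    V  = eval (divide r (b + r * a ∷ as)) x


module FieldProperties {c ℓ} (R : CommutativeRing c ℓ) (F : IsField R) where
  open CommutativeRing R
  open IsField F
  open RingProperties R using (eval; eval-≈0#∷; eval-zipWith-−; divide; eval-divide)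
  open import Relation.Binary.Reasoning.Setoid setoid
  open import Algebra.Properties.Group +-group using (x∙y⁻¹≈ε⇒x≈y; x≈y⇒x∙y⁻¹≈ε)
  open import Algebra.Properties.Ring ring using (-‿distribˡ-*)

  *-cancelˡ-≉0 : ∀ {x y z} → ¬ x ≈ 0# → x * y ≈ x * z → y ≈ z
  *-cancelˡ-≉0 {x} {y} {z} x≉0 xy≈xz = begin
    y                  ≈⟨ *-identityˡ y ⟨
    1# * y             ≈⟨ *-congʳ (trans (*-comm _ _) (inverseʳ x x≉0)) ⟨
    (x ⁻¹ * x) * y     ≈⟨ *-assoc _ x y ⟩
    x ⁻¹ * (x * y)     ≈⟨ *-congˡ xy≈xz ⟩
    x ⁻¹ * (x * z)     ≈⟨ *-assoc _ x z ⟨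
    (x ⁻¹ * x) * z     ≈⟨ *-congʳ (trans (*-comm _ _) (inverseʳ x x≉0)) ⟩
    1# * z             ≈⟨ *-identityˡ z ⟩
    z                  ∎

  *-cancelʳ-≉ : ∀ {x y z} → ¬ x ≈ y → x * z ≈ y * z → z ≈ 0#
  *-cancelʳ-≉ {x} {y} {z} x≉y xz≈yz = *-cancelˡ-≉0 (x≉y ∘ x∙y⁻¹≈ε⇒x≈y x y) (begin
    (x - y) * z         ≈⟨ distribʳ z x (- y) ⟩
    x * z + (- y) * z   ≈⟨ +-congˡ (-‿distribˡ-* y z) ⟨
    x * z - y * z       ≈⟨ x≈y⇒x∙y⁻¹≈ε xz≈yz ⟩
    0#                  ≈⟨ zeroʳ _ ⟨
    (x - y) * 0#        ∎)

  -- Dividing by X - r₀ keeps the leading coefficient and the remaining roots.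
  leading≈0 : ∀ {n} (P : Vec Carrier (suc n)) (r : Fin (suc n) → Carrier) → Injective _≡_ _≈_ r →
              (∀ i → eval P (r i) ≈ 0#) → head P ≈ 0#
  leading≈0 {zero} (a ∷ []) r _ roots = trans (sym (trans (+-identityʳ _) (*-identityʳ a))) (roots Fin.zero)
  leading≈0 {suc n} P@(a ∷ _ ∷ _) r r-inj roots =
    leading≈0 (divide r₀ P) (r ∘ Fin.suc) (Finₚ.suc-injective ∘ r-inj) quotient-roots
    where
    r₀ = r Fin.zero
    quotient-roots : ∀ i → eval (divide r₀ P) (r (Fin.suc i)) ≈ 0#
    quotient-roots i = *-cancelʳ-≉ (λ r₀≈s → case r-inj r₀≈s of λ ()) (begin
      r₀ * V             ≈⟨ +-identityˡ _ ⟨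
      0# + r₀ * V        ≈⟨ +-congʳ (roots (Fin.suc i)) ⟨
      eval P s + r₀ * V  ≈⟨ eval-divide r₀ s P ⟩
      s * V + eval P r₀  ≈⟨ +-congˡ (roots Fin.zero) ⟩
      s * V + 0#         ≈⟨ +-identityʳ _ ⟩
      s * V              ∎)
      where
      s = r (Fin.suc i)
      V = eval (divide r₀ P) s

  vanishing : ∀ {n} (P : Vec Carrier n) (r : Fin n → Carrier) → Injective _≡_ _≈_ r →
              (∀ i → eval P (r i) ≈ 0#) → All (_≈ 0#) P
  vanishing []       r _     _     = []
  vanishing (a ∷ as) r r-inj roots =
    a≈0 ∷ vanishing as (r ∘ Fin.suc) (Finₚ.suc-injective ∘ r-inj)
                    (λ i → trans (sym (eval-≈0#∷ as _ a≈0)) (roots (Fin.suc i)))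
    where
    a≈0 = leading≈0 (a ∷ as) r r-inj roots

  eval-injective : ∀ {n} (P Q : Vec Carrier n) (r : Fin n → Carrier) → Injective _≡_ _≈_ r →
                   (∀ i → eval P (r i) ≈ eval Q (r i)) → Pointwise _≈_ P Q
  eval-injective P Q r r-inj agree = ≋-from-difference P Q
    (vanishing (zipWith _-_ P Q) r r-inj (λ i → trans (eval-zipWith-− P Q (r i)) (x≈y⇒x∙y⁻¹≈ε (agree i))))
    where
    ≋-from-difference : ∀ {n} (P Q : Vec Carrier n) → All (_≈ 0#) (zipWith _-_ P Q) → Pointwise _≈_ P Q
    ≋-from-difference []      []      []         = []
    ≋-from-difference (a ∷ P) (b ∷ Q) (d≈0 ∷ ds) = x∙y⁻¹≈ε⇒x≈y a b d≈0 ∷ ≋-from-difference P Q ds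


module FiniteFieldProperties {c ℓ} (R : CommutativeRing c ℓ) (F : IsField R) {n} (card : HasCard R n) where
  open CommutativeRing R
  open IsField F using (1≉0)
  open RingProperties R using (1#^≈1#; Additive; additive⇒^-distrib-−; card×≈0)
  open import Algebra.Properties.Semiring.Mult semiring using (_×_; ×1-homo-*)
  open FieldProperties R F using (*-cancelˡ-≉0)
  open import Relation.Binary.Reasoning.Setoid setoid
  open import Algebra.Properties.Semiring.Exp semiring using (_^_; ^-congˡ; ^-congʳ; ^-homo-*; ^-assocʳ)
  open import Algebra.Properties.Group +-group using (x∙y⁻¹≈ε⇒x≈y; x≈y⇒x∙y⁻¹≈ε)
  private module C = Inverse card

  _≟_ : Decidable _≈_
  x ≟ y = map′ (Injection.injective (Inverse⇒Injection card)) C.to-cong (C.to x Fin.≟ C.to y)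

  ^≈0⇒≈0 : ∀ {x} m → x ^ m ≈ 0# → x ≈ 0#
  ^≈0⇒≈0     zero    1≈0 = contradiction 1≈0 1≉0
  ^≈0⇒≈0 {x} (suc m) x^[1+m]≈0 with x ≟ 0#
  ... | yes x≈0 = x≈0
  ... | no  x≉0 = ^≈0⇒≈0 m (*-cancelˡ-≉0 x≉0 (trans x^[1+m]≈0 (sym (zeroʳ x))))

  card≡m^j⇒char : ∀ {m j} → n ≡ m ℕ.^ j → m × 1# ≈ 0#
  card≡m^j⇒char {m} {j} n≡m^j = ^≈0⇒≈0 j (begin
    (m × 1#) ^ j     ≈⟨ ×1-^ j ⟨
    (m ℕ.^ j) × 1#   ≡⟨ ≡.cong (_× 1#) n≡m^j ⟨
    n × 1#           ≈⟨ card×≈0 card 1# ⟩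
    0#               ∎)
    where
    ×1-^ : ∀ j → (m ℕ.^ j) × 1# ≈ (m × 1#) ^ j
    ×1-^ zero    = +-identityʳ 1#
    ×1-^ (suc j) = trans (×1-homo-* m (m ℕ.^ j)) (*-congˡ (×1-^ j))

  additive⇒^-injective : ∀ {e} → Additive e → ∀ {x y} → x ^ e ≈ y ^ e → x ≈ y
  additive⇒^-injective {e} add-e {x} {y} x^e≈y^e =
    x∙y⁻¹≈ε⇒x≈y x y (^≈0⇒≈0 e (trans (additive⇒^-distrib-− {e} add-e x y) (x≈y⇒x∙y⁻¹≈ε x^e≈y^e)))

  -- If α ^ (N + 1) ≈ α then 0, α⁰, …, α^(N-1) exhaust R, so N + 1 ≥ n.
  module _ {α} (α≉0 : ¬ α ≈ 0#) (generates : ∀ x → ¬ x ≈ 0# → ∃ λ k → α ^ k ≈ x) where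
    primitive-^≈-bound : ∀ {m} → 1 < m → α ^ m ≈ α → n ≤ m
    primitive-^≈-bound {suc N@(suc _)} (s≤s (s≤s z≤n)) α^[1+N]≈α = ℕₚ.≮⇒≥ λ 1+N<n →
      let i , j , i<j , index-i≡index-j = Finₚ.pigeonhole 1+N<n index
      in Finₚ.<-irrefl (≡.trans (≡.sym (index-section i)) (≡.trans (≡.cong (C.to ∘ element) index-i≡index-j) (index-section j))) i<j
      where
      α^N≈1 : α ^ N ≈ 1#
      α^N≈1 = *-cancelˡ-≉0 α≉0 (trans α^[1+N]≈α (sym (*-identityʳ α)))

      α^≈α^% : ∀ k → α ^ k ≈ α ^ (k % N)
      α^≈α^% k = begin
        α ^ k                                ≡⟨ ≡.cong (α ^_) (m≡m%n+[m/n]*n k N) ⟩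
        α ^ (k % N ℕ.+ (k / N) ℕ.* N)        ≈⟨ ^-homo-* α (k % N) _ ⟩
        α ^ (k % N) * α ^ ((k / N) ℕ.* N)    ≈⟨ *-congˡ (trans (^-congʳ α (ℕₚ.*-comm (k / N) N)) (sym (^-assocʳ α N (k / N)))) ⟩
        α ^ (k % N) * (α ^ N) ^ (k / N)      ≈⟨ *-congˡ (trans (^-congˡ (k / N) α^N≈1) (1#^≈1# (k / N))) ⟩
        α ^ (k % N) * 1#                     ≈⟨ *-identityʳ _ ⟩
        α ^ (k % N)                          ∎

      element : Fin (suc N) → Carrier
      element Fin.zero    = 0#
      element (Fin.suc i) = α ^ toℕ i

      preimage : ∀ x → Σ (Fin (suc N)) λ i → element i ≈ x
      preimage x with x ≟ 0#
      ... | yes x≈0 = Fin.zero , sym x≈0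
      ... | no  x≉0 with k , α^k≈x ← generates x x≉0 =
        Fin.suc (Fin.fromℕ< (m%n<n k N)) ,
        trans (^-congʳ α (Finₚ.toℕ-fromℕ< (m%n<n k N))) (trans (sym (α^≈α^% k)) α^k≈x)

      index : Fin n → Fin (suc N)
      index y = proj₁ (preimage (C.from y))

      index-section : ∀ y → C.to (element (index y)) ≡ y
      index-section y = ≡.trans (C.to-cong (proj₂ (preimage (C.from y)))) (C.strictlyInverseˡ y)


module PowerBasis {c ℓ} (K : CommutativeRing c ℓ) {q} (FF : IsFiniteField K q) {p k} (pp : Prime p)
               (q≡p^[1+k] : q ≡ p ℕ.^ suc k) (α : CommutativeRing.Carrier K) (prim : IsPrimitive K FF α) where
  open CommutativeRing K
  open IsFiniteField FF using (isField; card; 1≉0)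
  open RingProperties K
  open FieldProperties K isField using (eval-injective)
  open FiniteFieldProperties K isField card
  open import Data.Product using (_×_)
  open import Data.Vec.Relation.Unary.All as All using ()
  open import Relation.Binary.Reasoning.Setoid setoid
  open import Algebra.Properties.Semiring.Exp semiring using (_^_; ^-congˡ; ^-assocʳ)
  open import Algebra.Properties.CommutativeSemiring.Exp commutativeSemiring using (^-distrib-*)
  open import Algebra.Properties.CommutativeSemigroup *-commutativeSemigroup using (x∙yz≈y∙xz)
  open import Algebra.Solver.Ring.NaturalCoefficients.Default commutativeSemiring

  Fq : Carrier → Set ℓ
  Fq = InFq K FF

  additive-q : Additive q
  additive-q = ≡.subst Additive (≡.sym q≡p^[1+k]) (additive-^ {p} (frobenius pp char-p) (suc k))
    where
    char-p = card≡m^j⇒char {p} {suc k ℕ.* 5} (≡.trans (≡.cong (ℕ._^ 5) q≡p^[1+k]) (ℕₚ.^-*-assoc p (suc k) 5))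

  Fq⇒^q≈ : ∀ {a} → Fq a → a ^ q ≈ a
  Fq⇒^q≈ {a} a∈Fq = trans (sym (pow≈^ a q)) a∈Fq

  ^q≈⇒Fq : ∀ {a} → a ^ q ≈ a → Fq a
  ^q≈⇒Fq {a} = trans (pow≈^ a q)

  Fq-0# : Fq 0#
  Fq-0# = ^q≈⇒Fq (additive⇒0#^≈0# {q} additive-q)

  Fq-1# : Fq 1#
  Fq-1# = ^q≈⇒Fq (1#^≈1# q)

  Fq-* : ∀ {a b} → Fq a → Fq b → Fq (a * b)
  Fq-* {a} {b} a∈Fq b∈Fq = ^q≈⇒Fq (trans (^-distrib-* a b q) (*-cong (Fq⇒^q≈ a∈Fq) (Fq⇒^q≈ b∈Fq)))

  Fq⇒^q^≈ : ∀ {a} → Fq a → ∀ i → a ^ (q ℕ.^ i) ≈ a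
  Fq⇒^q^≈ a∈Fq zero    = *-identityʳ _
  Fq⇒^q^≈ {a} a∈Fq (suc i) = begin
    a ^ (q ℕ.* q ℕ.^ i)   ≈⟨ ^-assocʳ a q (q ℕ.^ i) ⟨
    (a ^ q) ^ (q ℕ.^ i)   ≈⟨ ^-congˡ (q ℕ.^ i) (Fq⇒^q≈ a∈Fq) ⟩
    a ^ (q ℕ.^ i)         ≈⟨ Fq⇒^q^≈ a∈Fq i ⟩
    a                     ∎

  1<q : 1 < q
  1<q = ≡.subst (1 <_) (≡.sym q≡p^[1+k])
    (ℕₚ.^-monoʳ-< p (ℕ.nonTrivial⇒n>1 p {{prime⇒nonTrivial pp}}) {0} {suc k} (s≤s z≤n))

  -- α ^ q ^ a ≈ α ^ q ^ b pulls back along the injective Frobenius to α ^ q ^ (b ∸ a) ≈ α,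
  -- impossible for a primitive α since q ^ (b ∸ a) < q ^ 5.
  conjugates-distinct : ∀ {a b} → a < b → b < 5 → ¬ α ^ (q ℕ.^ a) ≈ α ^ (q ℕ.^ b)
  conjugates-distinct {a} {b} a<b b<5 α^q^a≈α^q^b =
    ℕₚ.<⇒≱ (ℕₚ.^-monoʳ-< q 1<q d<5) (primitive-^≈-bound α≉0 generates (ℕₚ.^-monoʳ-< q 1<q 0<d) α^q^d≈α)
    where
    d = b ∸ a
    0<d = ℕₚ.m<n⇒0<n∸m a<b
    d<5 = ℕₚ.≤-<-trans (ℕₚ.m∸n≤m b a) b<5
    α≉0 = proj₁ prim
    generates : ∀ x → ¬ x ≈ 0# → ∃ λ k → α ^ k ≈ x
    generates x x≉0 with k , α^k≈x ← proj₂ prim x x≉0 = k , trans (sym (pow≈^ α k)) α^k≈x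
    α^q^d≈α : α ^ (q ℕ.^ d) ≈ α
    α^q^d≈α = additive⇒^-injective {q ℕ.^ a} (additive-^ {q} additive-q a) (begin
      (α ^ (q ℕ.^ d)) ^ (q ℕ.^ a)  ≈⟨ ^-assocʳ α (q ℕ.^ d) (q ℕ.^ a) ⟩
      α ^ (q ℕ.^ d ℕ.* q ℕ.^ a)    ≡⟨ ≡.cong (α ^_) (ℕₚ.^-distribˡ-+-* q d a) ⟨
      α ^ (q ℕ.^ (d ℕ.+ a))        ≡⟨ ≡.cong (λ e → α ^ (q ℕ.^ e)) (ℕₚ.m∸n+n≡m (ℕₚ.<⇒≤ a<b)) ⟩
      α ^ (q ℕ.^ b)                ≈⟨ α^q^a≈α^q^b ⟨
      α ^ (q ℕ.^ a)                ∎)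

  conjugate : Fin 5 → Carrier
  conjugate i = α ^ (q ℕ.^ toℕ i)

  conjugate-injective : Injective _≡_ _≈_ conjugate
  conjugate-injective {i} {j} α^q^i≈α^q^j with ℕₚ.<-cmp (toℕ i) (toℕ j)
  ... | tri< i<j _ _ = contradiction α^q^i≈α^q^j (conjugates-distinct i<j (Finₚ.toℕ<n j))
  ... | tri≈ _ i≡j _ = Finₚ.toℕ-injective i≡j
  ... | tri> _ _ j<i = contradiction (sym α^q^i≈α^q^j) (conjugates-distinct j<i (Finₚ.toℕ<n i))

  -- A relation P(α) = Q(α) over F_q is preserved by Frobenius, so P and Q agree at the five conjugates of α.
  Fq-coordinates-unique : (P Q : Vec Carrier 5) → All Fq P → All Fq Q → eval P α ≈ eval Q α → Pointwise _≈_ P Q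
  Fq-coordinates-unique P Q P∈Fq Q∈Fq Pα≈Qα = eval-injective P Q conjugate conjugate-injective λ i → begin
    eval P (conjugate i)      ≈⟨ eval-^ {q ℕ.^ toℕ i} (additive-^ {q} additive-q (toℕ i)) P (fixed P∈Fq i) α ⟩
    eval P α ^ (q ℕ.^ toℕ i)  ≈⟨ ^-congˡ (q ℕ.^ toℕ i) Pα≈Qα ⟩
    eval Q α ^ (q ℕ.^ toℕ i)  ≈⟨ eval-^ {q ℕ.^ toℕ i} (additive-^ {q} additive-q (toℕ i)) Q (fixed Q∈Fq i) α ⟨
    eval Q (conjugate i)      ∎
    where
    fixed : ∀ {P : Vec Carrier 5} → All Fq P → ∀ i → All (λ a → a ^ (q ℕ.^ toℕ i) ≈ a) P
    fixed P∈Fq i = All.map (λ a∈Fq → Fq⇒^q^≈ a∈Fq (toℕ i)) P∈Fq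

  combination₁ : ∀ u v w → u ≈ (1# * u + 0# * v) + 0# * w
  combination₁ u v w = sym (trans (+-cong (+-cong (*-identityˡ u) (zeroˡ v)) (zeroˡ w)) (trans (+-identityʳ _) (+-identityʳ u)))

  combination₂ : ∀ u v w → v ≈ (0# * u + 1# * v) + 0# * w
  combination₂ u v w = sym (trans (+-cong (+-cong (zeroˡ u) (*-identityˡ v)) (zeroˡ w)) (trans (+-identityʳ _) (+-identityˡ v)))

  combination₃ : ∀ u v w → w ≈ (0# * u + 0# * v) + 1# * w
  combination₃ u v w = sym (trans (+-cong (+-cong (zeroˡ u) (zeroˡ v)) (*-identityˡ w)) (trans (+-congʳ (+-identityʳ 0#)) (+-identityˡ w)))

  ∈span3₁ : ∀ u v w → span3 K FF u v w u
  ∈span3₁ u v w = 1# , 0# , 0# , Fq-1# , Fq-0# , Fq-0# , combination₁ u v w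

  ∈span3₂ : ∀ u v w → span3 K FF u v w v
  ∈span3₂ u v w = 0# , 1# , 0# , Fq-0# , Fq-1# , Fq-0# , combination₂ u v w

  ∈span3₃ : ∀ u v w → span3 K FF u v w w
  ∈span3₃ u v w = 0# , 0# , 1# , Fq-0# , Fq-0# , Fq-1# , combination₃ u v w

  -- In the solver calls below 1# = α ^ 0 is an atom; every term is linear in it.
  a+bα+dα²-coordinates : ∀ c a b d → c * ((a * pow K α 0 + b * pow K α 1) + d * pow K α 2)
                                   ≈ eval (0# ∷ 0# ∷ c * d ∷ c * b ∷ c * a ∷ []) α
  a+bα+dα²-coordinates = solve 6 (λ o x c a b d →
      c :* ((a :* o :+ b :* (x :* o)) :+ d :* (x :* (x :* o)))
    := con 0 :* (x :* (x :* (x :* (x :* o)))) :+ (con 0 :* (x :* (x :* (x :* o)))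
       :+ ((c :* d) :* (x :* (x :* o)) :+ ((c :* b) :* (x :* o) :+ ((c :* a) :* o :+ con 0)))))
    refl 1# α

  a+bα+dα³-coordinates : ∀ a b d → (a * pow K α 0 + b * pow K α 1) + d * pow K α 3
                                  ≈ eval (0# ∷ d ∷ 0# ∷ b ∷ a ∷ []) α
  a+bα+dα³-coordinates = solve 5 (λ o x a b d →
      (a :* o :+ b :* (x :* o)) :+ d :* (x :* (x :* (x :* o)))
    := con 0 :* (x :* (x :* (x :* (x :* o)))) :+ (d :* (x :* (x :* (x :* o)))
       :+ (con 0 :* (x :* (x :* o)) :+ (b :* (x :* o) :+ (a :* o :+ con 0)))))
    refl 1# α

  α*[a+bα+dα³]-coordinates : ∀ a b d → α * ((a * pow K α 0 + b * pow K α 1) + d * pow K α 3)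
                                      ≈ eval (d ∷ 0# ∷ b ∷ a ∷ 0# ∷ []) α
  α*[a+bα+dα³]-coordinates = solve 5 (λ o x a b d →
      x :* ((a :* o :+ b :* (x :* o)) :+ d :* (x :* (x :* (x :* o))))
    := d :* (x :* (x :* (x :* (x :* o)))) :+ (con 0 :* (x :* (x :* (x :* o)))
       :+ (b :* (x :* (x :* o)) :+ (a :* (x :* o) :+ (con 0 :* o :+ con 0)))))
    refl 1# α

  X Y : Subset K FF
  X = span3 K FF (pow K α 0) (pow K α 1) (pow K α 2)
  Y = span3 K FF (pow K α 0) (pow K α 1) (pow K α 3)

  α³-coordinates : pow K α 3 ≈ eval (0# ∷ 1# ∷ 0# ∷ 0# ∷ 0# ∷ []) α
  α³-coordinates = trans (combination₃ _ _ _) (a+bα+dα³-coordinates 0# 0# 1#)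

  -- α · β and βα have coordinates (d′, 0, b′, a′, 0) and (0, d, 0, b, a), so b′ ≈ d′ ≈ 0.
  Fq-scalar : ∀ {β} → Y (β * pow K α 0) → Y (β * pow K α 1) → ∃ λ a → Fq a × β ≈ a
  Fq-scalar {β} (a′ , b′ , d′ , a′∈Fq , b′∈Fq , d′∈Fq , β≈) (a , b , d , a∈Fq , b∈Fq , d∈Fq , βα≈) =
    a′ , a′∈Fq , β≈a′ (Fq-coordinates-unique
      (d′ ∷ 0# ∷ b′ ∷ a′ ∷ 0# ∷ []) (0# ∷ d ∷ 0# ∷ b ∷ a ∷ [])
      (d′∈Fq ∷ Fq-0# ∷ b′∈Fq ∷ a′∈Fq ∷ Fq-0# ∷ []) (Fq-0# ∷ d∈Fq ∷ Fq-0# ∷ b∈Fq ∷ a∈Fq ∷ [])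
      (begin
        eval (d′ ∷ 0# ∷ b′ ∷ a′ ∷ 0# ∷ []) α                     ≈⟨ α*[a+bα+dα³]-coordinates a′ b′ d′ ⟨
        α * ((a′ * pow K α 0 + b′ * pow K α 1) + d′ * pow K α 3)  ≈⟨ *-congˡ β≈ ⟨
        α * (β * 1#)                                             ≈⟨ x∙yz≈y∙xz α β 1# ⟩
        β * pow K α 1                                            ≈⟨ βα≈ ⟩
        (a * pow K α 0 + b * pow K α 1) + d * pow K α 3          ≈⟨ a+bα+dα³-coordinates a b d ⟩
        eval (0# ∷ d ∷ 0# ∷ b ∷ a ∷ []) α                        ∎))
    where
    β≈a′ : Pointwise _≈_ (d′ ∷ 0# ∷ b′ ∷ a′ ∷ 0# ∷ []) (0# ∷ d ∷ 0# ∷ b ∷ a ∷ []) → β ≈ a′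
    β≈a′ (d′≈0 ∷ _ ∷ b′≈0 ∷ _ ∷ _ ∷ []) = begin
      β                                             ≈⟨ *-identityʳ β ⟨
      β * 1#                                        ≈⟨ β≈ ⟩
      (a′ * 1# + b′ * pow K α 1) + d′ * pow K α 3   ≈⟨ +-cong (+-cong (*-identityʳ a′) (*-congʳ b′≈0)) (*-congʳ d′≈0) ⟩
      (a′ + 0# * pow K α 1) + 0# * pow K α 3        ≈⟨ +-cong (+-congˡ (zeroˡ _)) (zeroˡ _) ⟩
      (a′ + 0#) + 0#                                ≈⟨ trans (+-identityʳ _) (+-identityʳ a′) ⟩
      a′                                            ∎

  -- α³ has coordinate 1 along α³, every element of a X with a ∈ F_q has coordinate 0.
  α³∉Fq-scaled-X : ∀ {a} → Fq a → ¬ scale K FF a X (pow K α 3)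
  α³∉Fq-scaled-X {a} a∈Fq (x , (u , v , w , u∈Fq , v∈Fq , w∈Fq , x≈) , α³≈ax) = 1≉0 (coefficient-of-α³ (Fq-coordinates-unique
    (0# ∷ 1# ∷ 0# ∷ 0# ∷ 0# ∷ []) (0# ∷ 0# ∷ a * w ∷ a * v ∷ a * u ∷ [])
    (Fq-0# ∷ Fq-1# ∷ Fq-0# ∷ Fq-0# ∷ Fq-0# ∷ [])
    (Fq-0# ∷ Fq-0# ∷ Fq-* a∈Fq w∈Fq ∷ Fq-* a∈Fq v∈Fq ∷ Fq-* a∈Fq u∈Fq ∷ [])
    (begin
      eval (0# ∷ 1# ∷ 0# ∷ 0# ∷ 0# ∷ []) α                  ≈⟨ α³-coordinates ⟨
      pow K α 3                                             ≈⟨ α³≈ax ⟩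
      a * x                                                 ≈⟨ *-congˡ x≈ ⟩
      a * ((u * pow K α 0 + v * pow K α 1) + w * pow K α 2) ≈⟨ a+bα+dα²-coordinates a u v w ⟩
      eval (0# ∷ 0# ∷ a * w ∷ a * v ∷ a * u ∷ []) α         ∎)))
    where
    coefficient-of-α³ : ∀ {P Q : Vec Carrier 3} → Pointwise _≈_ (0# ∷ 1# ∷ P) (0# ∷ 0# ∷ Q) → 1# ≈ 0#
    coefficient-of-α³ (_ ∷ 1≈0 ∷ _) = 1≈0

  not-scaling : ∀ β → ¬ SameSet K FF Y (scale K FF β X)
  not-scaling β Y≈βX =
    let a , a∈Fq , β≈a = Fq-scalar (βX⇒Y (pow K α 0 , ∈span3₁ _ _ _ , refl)) (βX⇒Y (pow K α 1 , ∈span3₂ _ _ _ , refl))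
        x , x∈X , α³≈βx = Equivalence.to (Y≈βX _) (∈span3₃ _ _ _)
    in α³∉Fq-scaled-X a∈Fq (x , x∈X , trans α³≈βx (*-congʳ β≈a))
    where
    βX⇒Y : ∀ {y} → scale K FF β X y → Y y
    βX⇒Y = Equivalence.from (Y≈βX _)

lemma15 : ∀ {c ℓ} (q : ℕ) → IsPrimePower q →
          (K : CommutativeRing c ℓ) (FF : IsFiniteField K q) →
          (α : CommutativeRing.Carrier K) → IsPrimitive K FF α →
          ¬ E₃ K FF α (span3 K FF (pow K α 0) (pow K α 1) (pow K α 2))
                      (span3 K FF (pow K α 0) (pow K α 1) (pow K α 3))
lemma15 q (p , k , pp , q≡p^[1+k]) K FF α prim (j , Y≈α^jX) =
  PowerBasis.not-scaling K FF {p} {k} pp q≡p^[1+k] α prim (zpow K FF α j) Y≈α^jX
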